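{- Every spider graph is odd prime.
   Context: All graphs are finite and simple. An odd prime labeling of a graph $G$ with $N$ vertices is a bijection $\ell:V(G)\to\{1,3,\dots,2N-1\}$ such that $\gcd(\ell(u),\ell(v))=1$ for every edge $uv$; $G$ is odd prime if it has one. A spider is a tree obtained from paths $P_{n_1},\dots,P_{n_k}$ (with $n_i\ge 1$ vertices) and one additional central vertex $v$ by joining $v$ to one end vertex of each path. -}

module Defs where

open import Data.Nat using (ℕ; zero; suc; _+_; _*_; _≤_)
open import Data.Nat.Coprimality using (Coprime)
open import Data.Fin using (Fin; toℕ)
open import Data.Product using (Σ; _×_; _,_)
open import Data.Sum using (_⊎_; inj₁; inj₂)
open import Data.Unit using (⊤; tt)
open import Function.Bundles using (_⤖_; Bijection)
open import Relation.Binary.PropositionalEquality using (_≡_)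

-- A finite simple graph: a vertex type with an adjacency relation.
-- (Finiteness of the vertex set is enforced by the labeling below,
-- which is a bijection onto Fin N.)
record Graph : Set₁ where
  field
    V   : Set
    Adj : V → V → Set

oddOf : {N : ℕ} → Fin N → ℕ
oddOf k = suc (2 * toℕ k)

-- An odd prime labeling of a graph G with N vertices: a bijection
-- V(G) → {1,3,…,2N-1} (encoded as V(G) ⤖ Fin N composed with oddOf)
-- such that adjacent vertices receive coprime labels.
OddPrimeLabeling : (G : Graph) (N : ℕ) → Set
OddPrimeLabeling G N =
  Σ (Graph.V G ⤖ Fin N) λ ℓ →
    ∀ u v → Graph.Adj G u v →
      Coprime (oddOf (Bijection.to ℓ u)) (oddOf (Bijection.to ℓ v))

IsOddPrime : Graph → Set
IsOddPrime G = Σ ℕ λ N → OddPrimeLabeling G N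

-- Vertices: the centre (inj₁ tt) and (i , j) for j < n i, the j-th vertex
-- of leg i; (i , 0) is the end vertex of leg i joined to the centre.
SpiderV : (k : ℕ) → (Fin k → ℕ) → Set
SpiderV k n = ⊤ ⊎ Σ (Fin k) (λ i → Fin (n i))

data SpiderAdj (k : ℕ) (n : Fin k → ℕ) : SpiderV k n → SpiderV k n → Set where
  hub-leg  : ∀ i (a : Fin (n i)) → toℕ a ≡ 0 →
             SpiderAdj k n (inj₁ tt) (inj₂ (i , a))
  leg-hub  : ∀ i (a : Fin (n i)) → toℕ a ≡ 0 →
             SpiderAdj k n (inj₂ (i , a)) (inj₁ tt)
  step-up  : ∀ i (a b : Fin (n i)) → suc (toℕ a) ≡ toℕ b →
             SpiderAdj k n (inj₂ (i , a)) (inj₂ (i , b))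
  step-down : ∀ i (a b : Fin (n i)) → suc (toℕ a) ≡ toℕ b →
             SpiderAdj k n (inj₂ (i , b)) (inj₂ (i , a))

Spider : (k : ℕ) → (Fin k → ℕ) → Graph
Spider k n = record { V = SpiderV k n ; Adj = SpiderAdj k n }

{-# OPTIONS --safe #-}
module Submission where

open import Defs
open import Data.Nat using (ℕ; _≤_; suc; _+_; _*_)
open import Data.Nat.Properties using (+-suc; +-assoc; +-comm; *-suc)
open import Data.Nat.Coprimality using (Coprime; 1-coprimeTo; coprime-+) renaming (sym to coprime-sym)
open import Data.Fin using (Fin; toℕ; zero; suc; splitAt; join; _↑ˡ_; _↑ʳ_)
open import Data.Fin.Properties using (toℕ-↑ˡ; toℕ-↑ʳ; splitAt-↑ˡ; splitAt-↑ʳ; join-splitAt)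
open import Data.Vec.Functional using (head; tail; foldr)
open import Data.Product as Product using (Σ; _,_)
open import Data.Sum using (inj₁; inj₂; [_,_]′)
open import Data.Unit using (tt)
open import Function using (_∘_; id)
open import Function.Bundles using (_↔_; mk↔ₛ′; Bijection)
open import Function.Properties.Inverse using (↔⇒⤖)
open import Relation.Binary.PropositionalEquality using (_≡_; refl; sym; trans; cong; subst; module ≡-Reasoning)

-- Label the centre 1 and list the legs one after another, each from its end
-- at the centre outwards, with the consecutive odd numbers 3, 5, 7, ….
-- Every edge then joins 1 to something, or two consecutive odd numbers,
-- and consecutive odd numbers are coprime since their difference is 2.

coprime-+ʳ : ∀ {m d} → Coprime m d → Coprime m (m + d)
coprime-+ʳ c = coprime-sym (coprime-+ (coprime-sym c))

odd-coprime-2 : ∀ t → Coprime (suc (2 * t)) 2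
odd-coprime-2 0       = 1-coprimeTo 2
odd-coprime-2 (suc t) = subst (λ m → Coprime m 2) (cong suc (sym (*-suc 2 t))) (coprime-+ (odd-coprime-2 t))

consecutive-odd-coprime : ∀ t → Coprime (suc (2 * t)) (suc (2 * suc t))
consecutive-odd-coprime t = subst (Coprime (suc (2 * t))) m+2≡next (coprime-+ʳ (odd-coprime-2 t))
  where
  m+2≡next : suc (2 * t) + 2 ≡ suc (2 * suc t)
  m+2≡next = trans (+-comm (suc (2 * t)) 2) (cong suc (sym (*-suc 2 t)))

oddOf-coprime-suc : ∀ {N} {a b : Fin N} → toℕ b ≡ suc (toℕ a) → Coprime (oddOf a) (oddOf b)
oddOf-coprime-suc {a = a} b≡1+a rewrite b≡1+a = consecutive-odd-coprime (toℕ a)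

sum : ∀ {k} → (Fin k → ℕ) → ℕ
sum = foldr _+_ 0

offset : ∀ {k} (n : Fin k → ℕ) → Fin k → ℕ
offset n zero    = 0
offset n (suc i) = head n + offset (tail n) i

flatten : ∀ {k} (n : Fin k → ℕ) → Σ (Fin k) (Fin ∘ n) → Fin (sum n)
flatten n (zero  , j) = j ↑ˡ sum (tail n)
flatten n (suc i , j) = head n ↑ʳ flatten (tail n) (i , j)

unflatten : ∀ {k} (n : Fin k → ℕ) → Fin (sum n) → Σ (Fin k) (Fin ∘ n)
unflatten {suc k} n x = [ zero ,_ , Product.map suc id ∘ unflatten (tail n) ]′ (splitAt (head n) x)

unflatten-flatten : ∀ {k} (n : Fin k → ℕ) p → unflatten n (flatten n p) ≡ p
unflatten-flatten n (zero , j) rewrite splitAt-↑ˡ (head n) j (sum (tail n)) = refl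
unflatten-flatten n (suc i , j)
  rewrite splitAt-↑ʳ (head n) (sum (tail n)) (flatten (tail n) (i , j))
        | unflatten-flatten (tail n) (i , j) = refl

flatten-unflatten : ∀ {k} (n : Fin k → ℕ) x → flatten n (unflatten n x) ≡ x
flatten-unflatten {suc k} n x = trans (flatten-split (splitAt (head n) x)) (join-splitAt (head n) _ x)
  where
  flatten-split : ∀ s → flatten n ([ zero ,_ , Product.map suc id ∘ unflatten (tail n) ]′ s) ≡ join (head n) _ s
  flatten-split (inj₁ j) = refl
  flatten-split (inj₂ y) = cong (head n ↑ʳ_) (flatten-unflatten (tail n) y)

toℕ-flatten : ∀ {k} (n : Fin k → ℕ) i j → toℕ (flatten n (i , j)) ≡ offset n i + toℕ j
toℕ-flatten n zero    j = toℕ-↑ˡ j _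
toℕ-flatten n (suc i) j = begin
  toℕ (head n ↑ʳ flatten (tail n) (i , j))  ≡⟨ toℕ-↑ʳ (head n) _ ⟩
  head n + toℕ (flatten (tail n) (i , j))   ≡⟨ cong (head n +_) (toℕ-flatten (tail n) i j) ⟩
  head n + (offset (tail n) i + toℕ j)      ≡⟨ sym (+-assoc (head n) _ (toℕ j)) ⟩
  offset n (suc i) + toℕ j                  ∎
  where open ≡-Reasoning

toℕ-flatten-suc : ∀ {k} (n : Fin k → ℕ) i (a b : Fin (n i)) → suc (toℕ a) ≡ toℕ b →
  toℕ (flatten n (i , b)) ≡ suc (toℕ (flatten n (i , a)))
toℕ-flatten-suc n i a b 1+a≡b = begin
  toℕ (flatten n (i , b))           ≡⟨ toℕ-flatten n i b ⟩
  offset n i + toℕ b                ≡⟨ cong (offset n i +_) (sym 1+a≡b) ⟩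
  offset n i + suc (toℕ a)          ≡⟨ +-suc (offset n i) (toℕ a) ⟩
  suc (offset n i + toℕ a)          ≡⟨ cong suc (sym (toℕ-flatten n i a)) ⟩
  suc (toℕ (flatten n (i , a)))     ∎
  where open ≡-Reasoning

spiderV↔Fin : ∀ k n → SpiderV k n ↔ Fin (suc (sum n))
spiderV↔Fin k n = mk↔ₛ′ to from to-from from-to
  where
  to : SpiderV k n → Fin (suc (sum n))
  to (inj₁ tt) = zero
  to (inj₂ p)  = suc (flatten n p)
  from : Fin (suc (sum n)) → SpiderV k n
  from zero    = inj₁ tt
  from (suc x) = inj₂ (unflatten n x)
  to-from : ∀ x → to (from x) ≡ x
  to-from zero    = refl
  to-from (suc x) = cong suc (flatten-unflatten n x)
  from-to : ∀ v → from (to v) ≡ v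
  from-to (inj₁ tt) = refl
  from-to (inj₂ p)  = cong inj₂ (unflatten-flatten n p)

spider-labeling-coprime : ∀ k n u v → SpiderAdj k n u v →
  let label = oddOf ∘ Bijection.to (↔⇒⤖ (spiderV↔Fin k n)) in Coprime (label u) (label v)
spider-labeling-coprime k n _ _ (hub-leg i a _)        = 1-coprimeTo _
spider-labeling-coprime k n _ _ (leg-hub i a _)        = coprime-sym (1-coprimeTo _)
spider-labeling-coprime k n _ _ (step-up i a b 1+a≡b)  =
  oddOf-coprime-suc (cong suc (toℕ-flatten-suc n i a b 1+a≡b))
spider-labeling-coprime k n _ _ (step-down i a b 1+a≡b) =
  coprime-sym (oddOf-coprime-suc (cong suc (toℕ-flatten-suc n i a b 1+a≡b)))

-- The legs need not be non-empty: an empty leg simply contributes no vertices.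
mainTheorem11 : (k : ℕ) (n : Fin k → ℕ) → (∀ i → 1 ≤ n i) →
    IsOddPrime (Spider k n)
mainTheorem11 k n _ = suc (sum n) , ↔⇒⤖ (spiderV↔Fin k n) , spider-labeling-coprime k n
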